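{- Let $G$ be a minimal non-strongly-perfect graph. Then $G$ has no simplicial vertex.
   Context: All graphs are finite and simple. A strong stable set of a graph is a stable set meeting every nonempty maximal clique of the graph. A graph is strongly perfect if every induced subgraph of it has a strong stable set. A graph is minimal non-strongly-perfect if it is not strongly perfect but every proper induced subgraph of it is strongly perfect. A vertex is simplicial if its neighbourhood is a clique. -}

module Defs where

open import Data.Nat using (ℕ)
open import Data.Fin using (Fin)
open import Data.Fin.Subset using (Subset; _∈_; _∉_; _⊆_; ⊤)
open import Data.Product using (Σ; ∃; _×_; _,_)
open import Relation.Nullary using (¬_; Dec)
open import Relation.Binary.PropositionalEquality using (_≡_; _≢_)
open import Level using (0ℓ; suc)

record Graph : Set₁ where
  field
    n     : ℕ
    Adj   : Fin n → Fin n → Set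
    sym   : ∀ {u v} → Adj u v → Adj v u
    irrefl : ∀ {u} → ¬ Adj u u
    adj?   : ∀ u v → Dec (Adj u v)

open Graph public

module _ (G : Graph) where

  V : Set
  V = Fin (n G)

  -- Everything below is relative to the induced subgraph G[S], S ⊆ V(G).

  IsClique : Subset (n G) → Subset (n G) → Set
  IsClique S K = K ⊆ S × (∀ {u v} → u ∈ K → v ∈ K → u ≢ v → Adj G u v)

  IsMaximalClique : Subset (n G) → Subset (n G) → Set
  IsMaximalClique S K =
    IsClique S K ×
    (∀ {v} → v ∈ S → v ∉ K → Σ V (λ u → u ∈ K × ¬ Adj G u v))

  IsStable : Subset (n G) → Subset (n G) → Set
  IsStable S T = T ⊆ S × (∀ {u v} → u ∈ T → v ∈ T → ¬ Adj G u v)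

  IsStrongStable : Subset (n G) → Subset (n G) → Set
  IsStrongStable S T =
    IsStable S T ×
    (∀ K → IsMaximalClique S K → Σ V (λ w → w ∈ K) → Σ V (λ w → w ∈ K × w ∈ T))

  HasStrongStableSet : Subset (n G) → Set
  HasStrongStableSet S = Σ (Subset (n G)) (IsStrongStable S)

  StronglyPerfectOn : Subset (n G) → Set
  StronglyPerfectOn S = ∀ S′ → S′ ⊆ S → HasStrongStableSet S′

  StronglyPerfect : Set
  StronglyPerfect = StronglyPerfectOn ⊤

  MinimalNonStronglyPerfect : Set
  MinimalNonStronglyPerfect =
    ¬ StronglyPerfect ×
    (∀ S → Σ V (λ v → v ∉ S) → StronglyPerfectOn S)

  Simplicial : V → Set
  Simplicial v = ∀ {x y} → Adj G v x → Adj G v y → x ≢ y → Adj G x y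

module Submission where

open import Defs
open import Relation.Nullary using (¬_; yes; no)
open import Data.Product using (Σ; _,_; _×_)
open import Data.Sum using (inj₁; inj₂)
open import Data.Fin using (Fin; zero; suc; _≟_)
open import Data.Fin.Properties using (any?)
open import Data.Fin.Subset using (Subset; _∈_; _∉_; _⊆_; _∪_; ⁅_⁆; _-_)
open import Data.Fin.Subset.Properties
  using (_∈?_; ⊆-refl; ⊆-trans; p─q⊆p; p⊆p∪q; x∈p∪q⁺; x∈p∪q⁻; x∈⁅x⁆; x∈⁅y⁆⇒x≡y; x∈p∧x≢y⇒x∈p-y)
open import Data.Vec.Base using (_∷_; there)
open import Relation.Nullary.Decidable using (_×-dec_)
open import Relation.Binary.PropositionalEquality using (_≢_; refl)
open import Data.Empty using (⊥-elim)

-- If v is simplicial and v ∈ S, take a strong stable set T of G[S - v]. Every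
-- maximal clique of G[S] avoiding v is a maximal clique of G[S - v], so only
-- cliques through v can be missed; such a clique is the whole closed
-- neighbourhood of v in S. Hence T itself works when it contains a neighbour
-- of v, and T ∪ {v} is stable and works otherwise. So a minimal
-- non-strongly-perfect graph with a simplicial vertex would be strongly perfect.

x∉p-x : ∀ {n} (p : Subset n) (x : Fin n) → x ∉ p - x
x∉p-x (_ ∷ p) zero    ()
x∉p-x (_ ∷ p) (suc x) (there h) = x∉p-x p x h

module _ (G : Graph) where

  maximalClique-restrict : ∀ {S S′ K} → S′ ⊆ S → K ⊆ S′ →
                           IsMaximalClique G S K → IsMaximalClique G S′ K
  maximalClique-restrict S′⊆S K⊆S′ ((_ , clique) , maximal) =
    (K⊆S′ , clique) , λ x∈S′ → maximal (S′⊆S x∈S′)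

  maximalClique-avoiding : ∀ {S K v} → v ∉ K →
                           IsMaximalClique G S K → IsMaximalClique G (S - v) K
  maximalClique-avoiding {S} {K} {v} v∉K mK@((K⊆S , _) , _) =
    maximalClique-restrict (p─q⊆p S ⁅ v ⁆) K⊆S-v mK
    where
    K⊆S-v : K ⊆ S - v
    K⊆S-v x∈K = x∈p∧x≢y⇒x∈p-y (K⊆S x∈K) λ { refl → v∉K x∈K }

  simplicial-maximalClique-∋-neighbour : ∀ {S K v u} → Simplicial G v →
    IsMaximalClique G S K → v ∈ K → u ∈ S → Adj G v u → u ∈ K
  simplicial-maximalClique-∋-neighbour {K = K} {v} {u} simplicial ((_ , clique) , maximal) v∈K u∈S vu
    with u ∈? K
  ... | yes u∈K = u∈K
  ... | no u∉K with maximal u∈S u∉K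
  ...   | w , w∈K , ¬wu with w ≟ v
  ...     | yes refl = ⊥-elim (¬wu vu)
  ...     | no w≢v   = ⊥-elim (¬wu (sym G (simplicial vu vw u≢w)))
    where
    vw : Adj G v w
    vw = clique v∈K w∈K λ { refl → w≢v refl }
    u≢w : u ≢ w
    u≢w refl = u∉K w∈K

  stable-insert : ∀ {S T v} → IsStable G S T → v ∈ S →
                  (∀ {u} → u ∈ T → ¬ Adj G v u) → IsStable G S (T ∪ ⁅ v ⁆)
  stable-insert {S} {T} {v} (T⊆S , stable) v∈S v-T = T∪v⊆S , stable′
    where
    T∪v⊆S : T ∪ ⁅ v ⁆ ⊆ S
    T∪v⊆S x∈ with x∈p∪q⁻ T ⁅ v ⁆ x∈
    ... | inj₁ x∈T = T⊆S x∈T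
    ... | inj₂ x∈v with x∈⁅y⁆⇒x≡y v x∈v
    ...   | refl = v∈S
    stable′ : ∀ {x y} → x ∈ T ∪ ⁅ v ⁆ → y ∈ T ∪ ⁅ v ⁆ → ¬ Adj G x y
    stable′ x∈ y∈ with x∈p∪q⁻ T ⁅ v ⁆ x∈ | x∈p∪q⁻ T ⁅ v ⁆ y∈
    ... | inj₁ x∈T | inj₁ y∈T = stable x∈T y∈T
    ... | inj₁ x∈T | inj₂ y∈v with x∈⁅y⁆⇒x≡y v y∈v
    ...   | refl = λ xv → v-T x∈T (sym G xv)
    stable′ x∈ y∈ | inj₂ x∈v | inj₁ y∈T with x∈⁅y⁆⇒x≡y v x∈v
    ...   | refl = v-T y∈T
    stable′ x∈ y∈ | inj₂ x∈v | inj₂ y∈v with x∈⁅y⁆⇒x≡y v x∈v | x∈⁅y⁆⇒x≡y v y∈v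
    ...   | refl | refl = irrefl G

  strongStable-lift : ∀ {S v T T′} → IsStrongStable G (S - v) T → T ⊆ T′ →
    IsStable G S T′ →
    (∀ {K} → IsMaximalClique G S K → v ∈ K → Σ (V G) λ w → w ∈ K × w ∈ T′) →
    IsStrongStable G S T′
  strongStable-lift {S} {v} {T′ = T′} (_ , meetsT) T⊆T′ stable meetsThroughV = stable , meets
    where
    meets : ∀ K → IsMaximalClique G S K → Σ (V G) (_∈ K) → Σ (V G) λ w → w ∈ K × w ∈ T′
    meets K mK nonempty with v ∈? K
    ... | yes v∈K = meetsThroughV mK v∈K
    ... | no v∉K with meetsT K (maximalClique-avoiding v∉K mK) nonempty
    ...   | w , w∈K , w∈T = w , w∈K , T⊆T′ w∈T

  hasStrongStableSet-addSimplicial : ∀ {S v} → Simplicial G v → v ∈ S →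
    HasStrongStableSet G (S - v) → HasStrongStableSet G S
  hasStrongStableSet-addSimplicial {S} {v} simplicial v∈S (T , strongT@((T⊆S-v , stableT) , _))
    with any? (λ u → (u ∈? T) ×-dec adj? G v u)
  ... | yes (u , u∈T , vu) =
    T , strongStable-lift strongT ⊆-refl (T⊆S , stableT)
          λ mK v∈K → u , simplicial-maximalClique-∋-neighbour simplicial mK v∈K (T⊆S u∈T) vu , u∈T
    where
    T⊆S : T ⊆ S
    T⊆S = ⊆-trans T⊆S-v (p─q⊆p S ⁅ v ⁆)
  ... | no noNeighbour =
    T ∪ ⁅ v ⁆ ,
    strongStable-lift strongT (p⊆p∪q ⁅ v ⁆)
      (stable-insert (⊆-trans T⊆S-v (p─q⊆p S ⁅ v ⁆) , stableT) v∈S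
        λ u∈T vu → noNeighbour (_ , u∈T , vu))
      λ _ v∈K → v , v∈K , x∈p∪q⁺ (inj₂ (x∈⁅x⁆ v))

lemma2p3 : (G : Graph) → MinimalNonStronglyPerfect G → ¬ Σ (V G) (Simplicial G)
lemma2p3 G (notStronglyPerfect , minimal) (v , simplicial) =
  notStronglyPerfect λ S _ → hasStrongStableSet S
  where
  hasStrongStableSet : ∀ S → HasStrongStableSet G S
  hasStrongStableSet S with v ∈? S
  ... | no v∉S  = minimal S (v , v∉S) S ⊆-refl
  ... | yes v∈S = hasStrongStableSet-addSimplicial G simplicial v∈S
                    (minimal (S - v) (v , x∉p-x S v) (S - v) ⊆-refl)
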